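{- Let $G$ be a finite, simple, connected graph that is $2K_2$-free. Then the cop number of $G$ satisfies $c(G) \leq 3$.
   Context: $2K_2$ denotes the graph consisting of two disjoint edges (the complement of the 4-cycle). A graph $G$ is $H$-free if it contains no induced subgraph isomorphic to $H$. The game of cops and robbers on $G$: $k$ cops each choose a starting vertex, then a single robber chooses a vertex; then players alternate turns starting with the cops. On the cops' turn each cop stays put or moves to an adjacent vertex; on the robber's turn he stays put or moves to an adjacent vertex. All moves are visible to both sides. The cops win if at some point a cop occupies the robber's vertex. The cop number $c(G)$ is the minimum number $k$ of cops for which the cops have a winning strategy on $G$. -}

module Defs where

open import Data.Nat using (ℕ; _≤_; _<_)
open import Data.Fin using (Fin)
open import Data.Product using (Σ; ∃; ∃-syntax; _×_; _,_)
open import Data.Sum using (_⊎_)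
open import Relation.Nullary using (¬_; Dec)
open import Relation.Binary.PropositionalEquality using (_≡_; _≢_)
open import Relation.Binary.Construct.Closure.ReflexiveTransitive using (Star)

record Graph : Set₁ where
  field
    n      : ℕ
    _~_    : Fin n → Fin n → Set
    sym    : ∀ {u v} → u ~ v → v ~ u
    irrefl : ∀ {u} → ¬ (u ~ u)
    dec    : ∀ u v → Dec (u ~ v)

module _ (G : Graph) where
  open Graph G

  Connected : Set
  Connected = (0 < n) × (∀ u v → Star _~_ u v)

  Has2K2 : Set
  Has2K2 = ∃[ a ] ∃[ b ] ∃[ c ] ∃[ d ]
    ( (a ≢ b) × (a ≢ c) × (a ≢ d) × (b ≢ c) × (b ≢ d) × (c ≢ d)
    × (a ~ b) × (c ~ d)
    × ¬ (a ~ c) × ¬ (a ~ d) × ¬ (b ~ c) × ¬ (b ~ d) )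

  2K2-free : Set
  2K2-free = ¬ Has2K2

  Step : Fin n → Fin n → Set
  Step u v = (u ≡ v) ⊎ (u ~ v)

  module _ (k : ℕ) where
    Config : Set
    Config = Fin k → Fin n

    Captured : Config → Fin n → Set
    Captured c r = ∃[ i ] (c i ≡ r)

    -- CopsWinFrom c r : it is the cops' turn, cops at c, robber at r, and
    -- the cops can force capture in finitely many moves (inductive = the
    -- cops have a strategy that wins against every robber play).
    data CopsWinFrom (c : Config) (r : Fin n) : Set where
      caught : Captured c r → CopsWinFrom c r
      move   : (c' : Config) → (∀ i → Step (c i) (c' i)) →
               (Captured c' r ⊎ (∀ r' → Step r r' → CopsWinFrom c' r')) →
               CopsWinFrom c r

    CopsWin : Set
    CopsWin = ∃[ c ] (∀ r → CopsWinFrom c r)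

  CopNumber≤ : ℕ → Set
  CopNumber≤ m = ∃[ k ] ((k ≤ m) × CopsWin k)

module Submission where

-- Put two cops on the ends of an edge uv and let them stay there.
-- A vertex r is *dominated* by uv if r is u, v or a neighbour of one of
-- them; a robber on a dominated vertex is caught in one cop move.  The key
-- graph-theoretic fact (`escape-is-dominated`) is that in a 2K₂-free graph
-- every neighbour of an undominated vertex is dominated: otherwise uv and
-- the edge rr' would form an induced 2K₂.  Hence a robber starting on an
-- undominated vertex can never move without being caught, so the third cop
-- just walks to him along a fixed walk (`hunt`).

open import Defs
open import Data.Nat.Properties using (≤-refl)
open import Data.Fin using (Fin; zero; suc; fromℕ<)
open import Data.Fin.Properties using (any?; _≟_)
open import Data.Vec.Functional using ([]; _∷_; updateAt)
open import Data.Vec.Functional.Properties using (updateAt-updates; updateAt-minimal)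
open import Data.Product using (_,_)
open import Data.Sum using (_⊎_; inj₁; inj₂)
open import Data.Empty using (⊥-elim)
open import Relation.Nullary using (¬_; yes; no)
open import Relation.Nullary.Decidable using (_⊎-dec_)
open import Relation.Binary.PropositionalEquality
  using (_≡_; _≢_; refl; sym; ≢-sym; subst)
open import Relation.Binary.Construct.Closure.ReflexiveTransitive using (Star; ε; _◅_)

module _ {G : Graph} where
  open Graph G renaming (sym to ~-sym)

  adjacent⇒distinct : ∀ {x y} → x ~ y → x ≢ y
  adjacent⇒distinct x~y refl = irrefl x~y

  separated⇒distinct : ∀ {w x y} → w ~ x → ¬ (w ~ y) → x ≢ y
  separated⇒distinct w~x w≁y refl = w≁y w~x

  capture-in-reach : ∀ {k} (c : Config G k) (i : Fin k) {r} →
                     Step G (c i) r → CopsWinFrom G k c r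
  capture-in-reach c i {r} reach =
    move c′ steps (inj₁ (i , updateAt-updates i c))
    where
      c′ : Config G _
      c′ = updateAt c i (λ _ → r)

      steps : ∀ j → Step G (c j) (c′ j)
      steps j with j ≟ i
      ... | yes refl = subst (Step G (c j)) (sym (updateAt-updates j c)) reach
      ... | no j≢i   = inj₁ (sym (updateAt-minimal j i c j≢i))

  Dominated : Fin n → Fin n → Fin n → Set
  Dominated u v r = Step G u r ⊎ Step G v r

  dominated? : ∀ u v r → Dominated u v r ⊎ ¬ Dominated u v r
  dominated? u v r with ((u ≟ r) ⊎-dec dec u r) ⊎-dec ((v ≟ r) ⊎-dec dec v r)
  ... | yes d = inj₁ d
  ... | no ¬d = inj₂ ¬d

  module _ (free : 2K2-free G) {u v : Fin n} (u~v : u ~ v) where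

    -- The 2K₂ lemma: a robber on a vertex not dominated by the edge uv can
    -- only move to dominated vertices, as r r' and u v would otherwise be
    -- an induced 2K₂.
    escape-is-dominated : ∀ {r r′} → ¬ Dominated u v r → r ~ r′ →
                          Dominated u v r′
    escape-is-dominated {r} {r′} ¬dom r~r′
      with dec u r′ | dec v r′
    ... | yes u~r′ | _        = inj₁ (inj₂ u~r′)
    ... | no _     | yes v~r′ = inj₂ (inj₂ v~r′)
    ... | no u≁r′  | no v≁r′  = ⊥-elim (free (u , v , r , r′ ,
          adjacent⇒distinct u~v ,
          separated⇒distinct (~-sym u~v) v≁r ,
          ≢-sym (separated⇒distinct r~r′ (λ r~u → u≁r (~-sym r~u))) ,
          separated⇒distinct u~v u≁r ,
          ≢-sym (separated⇒distinct r~r′ (λ r~v → v≁r (~-sym r~v))) ,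
          adjacent⇒distinct r~r′ ,
          u~v , r~r′ , u≁r , u≁r′ , v≁r , v≁r′))
      where
        u≁r : ¬ (u ~ r)
        u≁r u~r = ¬dom (inj₁ (inj₂ u~r))
        v≁r : ¬ (v ~ r)
        v≁r v~r = ¬dom (inj₂ (inj₂ v~r))

    guard : Fin n → Config G 3
    guard x = u ∷ v ∷ x ∷ []

    catch-dominated : ∀ x {r} → Dominated u v r → CopsWinFrom G 3 (guard x) r
    catch-dominated x (inj₁ u⇝r) = capture-in-reach (guard x) zero u⇝r
    catch-dominated x (inj₂ v⇝r) = capture-in-reach (guard x) (suc zero) v⇝r

    -- The hunter walks to an undominated robber along a walk x ⇝ r; the robber
    -- must stay put, since any move lands on a dominated vertex.
    hunt : ∀ x r → Star _~_ x r → ¬ Dominated u v r → CopsWinFrom G 3 (guard x) r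
    hunt x .x ε      ¬dom = caught (suc (suc zero) , refl)
    hunt x r  (_◅_ {j = y} x~y walk) ¬dom = move (guard y) advance (inj₂ reply)
      where
        advance : ∀ i → Step G (guard x i) (guard y i)
        advance zero             = inj₁ refl
        advance (suc zero)       = inj₁ refl
        advance (suc (suc zero)) = inj₂ x~y

        reply : ∀ r′ → Step G r r′ → CopsWinFrom G 3 (guard y) r′
        reply .r (inj₁ refl) = hunt y r walk ¬dom
        reply r′ (inj₂ r~r′) = catch-dominated y (escape-is-dominated ¬dom r~r′)

    guard-wins : (∀ a b → Star _~_ a b) → ∀ r → CopsWinFrom G 3 (guard u) r
    guard-wins walks r with dominated? u v r
    ... | inj₁ dom  = catch-dominated u dom
    ... | inj₂ ¬dom = hunt u r (walks u r) ¬dom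

  isolated-is-everything : Connected G → ∀ z → (∀ y → ¬ (z ~ y)) → ∀ r → z ≡ r
  isolated-is-everything (_ , walks) z lonely r with walks z r
  ... | ε          = refl
  ... | z~y ◅ _    = ⊥-elim (lonely _ z~y)

proposition1 : (G : Graph) → Connected G → 2K2-free G → CopNumber≤ G 3
proposition1 G conn@(nonempty , walks) free = start-near (fromℕ< nonempty)
  where
    open Graph G using (n; dec)

    start-near : Fin n → CopNumber≤ G 3
    start-near z with any? (dec z)
    ... | yes (_ , z~v) = 3 , ≤-refl , guard {G} free z~v z , guard-wins {G} free z~v walks
    ... | no no-edge    = 3 , ≤-refl , (λ _ → z) , λ r →
          caught (zero , isolated-is-everything {G} conn z (λ y z~y → no-edge (y , z~y)) r)
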